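{- Let $P=\forall X\forall Y(((X\to Y)\to X)\to X)$, $Q=P\to\forall X\,X$, $N=\forall X(X\to(X\to X)\to X)$, $D=(Q\to P)\to N$, $B=\forall X(X\to X\to X)$, $T=\lambda x\lambda y\,x$, $F=\lambda x\lambda y\,y$. For every closed normal $\lambda$-term $t$: $\vdash_{\mathcal{F}}t:D\to B$ if and only if $t=\lambda\alpha\,T$ or $t=\lambda\alpha\,F$.
   Context: System $\mathcal{F}$ (Girard's second-order typed $\lambda$-calculus): types built from type variables and $\perp$ with $\to$ and $\forall X$; typing rules: variable, $\lambda$-abstraction, application, $\forall$-introduction (type variable not free in context), $\forall$-elimination. -}

module Defs where

open import Data.Nat using (ℕ; zero; suc; _<ᵇ_; _≡ᵇ_; pred)
open import Data.Bool using (if_then_else_)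
open import Data.Fin using (Fin)
open import Data.Vec using (Vec; _∷_; []; lookup; map)

infixr 7 _⇒_
data Ty : Set where
  tv  : ℕ → Ty
  ⊥'  : Ty
  _⇒_ : Ty → Ty → Ty
  ∀'  : Ty → Ty            -- ∀' A binds tv 0 in A

shift : ℕ → Ty → Ty
shift c (tv k)  = if k <ᵇ c then tv k else tv (suc k)
shift c ⊥'      = ⊥'
shift c (A ⇒ B) = shift c A ⇒ shift c B
shift c (∀' A)  = ∀' (shift (suc c) A)

-- tsubst j S A : substitute S for variable j in A (capture-avoiding),
-- decrementing free variables above j (the binder is consumed).
tsubst : ℕ → Ty → Ty → Ty
tsubst j S (tv k)  = if k ≡ᵇ j then S else (if k <ᵇ j then tv k else tv (pred k))
tsubst j S ⊥'      = ⊥'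
tsubst j S (A ⇒ B) = tsubst j S A ⇒ tsubst j S B
tsubst j S (∀' A)  = ∀' (tsubst (suc j) (shift 0 S) A)

_[_] : Ty → Ty → Ty
A [ S ] = tsubst 0 S A

-- Untyped (Curry-style) λ-terms, well-scoped de Bruijn: Tm n has n free vars.
data Tm (n : ℕ) : Set where
  var : Fin n → Tm n
  lam : Tm (suc n) → Tm n
  app : Tm n → Tm n → Tm n

data Neutral {n : ℕ} : Tm n → Set
data Normal  {n : ℕ} : Tm n → Set
data Neutral {n} where
  var : (i : Fin n) → Neutral (var i)
  app : {t u : Tm n} → Neutral t → Normal u → Neutral (app t u)
data Normal {n} where
  ne  : {t : Tm n} → Neutral t → Normal t
  lam : {t : Tm (suc n)} → Normal t → Normal (lam t)

-- Typing rules of System F (Curry style).  The ∀-introduction side condition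
-- "X not free in Γ" is realised in de Bruijn style by shifting the context.
infix 4 _⊢_∶_
data _⊢_∶_ {n : ℕ} (Γ : Vec Ty n) : Tm n → Ty → Set where
  ax   : (i : Fin n) → Γ ⊢ var i ∶ lookup Γ i
  ⇒I   : {A B : Ty} {t : Tm (suc n)} → (A ∷ Γ) ⊢ t ∶ B → Γ ⊢ lam t ∶ A ⇒ B
  ⇒E   : {A B : Ty} {t u : Tm n} → Γ ⊢ t ∶ A ⇒ B → Γ ⊢ u ∶ A → Γ ⊢ app t u ∶ B
  ∀I   : {A : Ty} {t : Tm n} → map (shift 0) Γ ⊢ t ∶ A → Γ ⊢ t ∶ ∀' A
  ∀E   : {A : Ty} {t : Tm n} (S : Ty) → Γ ⊢ t ∶ ∀' A → Γ ⊢ t ∶ A [ S ]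

infix 4 ⊢_∶_
⊢_∶_ : Tm 0 → Ty → Set
⊢ t ∶ A = [] ⊢ t ∶ A

-- P = ∀X∀Y(((X→Y)→X)→X)   (inside: X = tv 1, Y = tv 0)
P : Ty
P = ∀' (∀' (((tv 1 ⇒ tv 0) ⇒ tv 1) ⇒ tv 1))

Q : Ty
Q = P ⇒ ∀' (tv 0)

N : Ty
N = ∀' (tv 0 ⇒ (tv 0 ⇒ tv 0) ⇒ tv 0)

D : Ty
D = (Q ⇒ P) ⇒ N

B : Ty
B = ∀' (tv 0 ⇒ tv 0 ⇒ tv 0)

-- λα T = λα λx λy x ,  λα F = λα λx λy y
λT : Tm 0
λT = lam (lam (lam (var (Fin.suc Fin.zero))))
  where import Data.Fin as Fin

λF : Tm 0
λF = lam (lam (lam (var Fin.zero)))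
  where import Data.Fin as Fin

-- A β-normal inhabitant of D ⇒ B in a context of D and type variables is a variable or a
-- λ-abstraction: the head of a neutral application would be a variable whose type is an
-- instance of D or of a type variable, so it would have to be D applied to an argument of type
-- Q ⇒ P.  That type is empty, by soundness for a Kripke model on (ℕ, ≤) in which types denote
-- up-sets and ∀ ranges over the up-sets [n, ∞) and ∅: there D is valid and Peirce's law P fails
-- at every world, so Q holds and Q ⇒ P cannot.  Once applications are excluded, the type
-- D ⇒ ∀X (X → X → X) leaves only λα λx λy x and λα λx λy y.

module Submission where

open import Defs
open import Data.Bool using (true; false)
open import Data.Empty using (⊥; ⊥-elim)
open import Data.Fin using (Fin; zero; suc)
open import Data.Maybe using (Maybe; just; nothing)
open import Data.Nat using (ℕ; zero; suc; _+_; _≤_; _<_; _<ᵇ_; _≡ᵇ_; z≤n; s≤s; _≤?_; _<?_)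
open import Data.Nat.Properties
  using (<⇒<ᵇ; <ᵇ⇒<; ≡⇒≡ᵇ; ≡ᵇ⇒≡; <-cmp; <⇒≢; <⇒≱; ≮⇒≥; ≤-refl; ≤-trans; <-≤-trans;
         m<n⇒m<1+n; n≤1+n; 1+n≰n; +-suc; +-identityʳ)
open import Data.Product using (_×_; ∃-syntax; _,_; proj₁; proj₂)
open import Data.Sum using (_⊎_; inj₁; inj₂)
import Data.Sum as Sum
open import Data.Vec using (Vec; []; _∷_; lookup; map)
open import Data.Vec.Properties using (lookup-map; map-∘; map-cong; map-id)
open import Data.Vec.Relation.Unary.All as All using (All; []; _∷_)
open import Data.Vec.Relation.Unary.All.Properties using (lookup⁺; map⁺)
open import Effect.Monad using (RawMonad)
open import Function using (_∘_; id)
open import Level using (0ℓ)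
open import Relation.Binary using (tri<; tri≈; tri>)
open import Relation.Binary.PropositionalEquality
  using (_≡_; _≢_; refl; sym; trans; cong; cong₂; subst; module ≡-Reasoning)
open import Relation.Nullary using (¬_; yes; no; contradiction; Stable; ¬¬-map)
open import Relation.Nullary.Decidable using (decidable-stable; ¬¬-excluded-middle)
open import Relation.Nullary.Negation using (¬¬-Monad)
open import Relation.Unary using (Pred; _≐_)
open import Relation.Unary.Properties using (≐-refl; ≐-trans)

open ≡-Reasoning

shift-tv-< : ∀ {c k} → k < c → shift c (tv k) ≡ tv k
shift-tv-< {c} {k} k<c with k <ᵇ c | <⇒<ᵇ k<c
... | true | _ = refl

shift-tv-≥ : ∀ {c k} → c ≤ k → shift c (tv k) ≡ tv (suc k)
shift-tv-≥ {c} {k} c≤k with k <ᵇ c | <ᵇ⇒< k c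
... | false | _ = refl
... | true | k<c = contradiction c≤k (<⇒≱ (k<c _))

tsubst-tv-≡ : ∀ j S → tsubst j S (tv j) ≡ S
tsubst-tv-≡ j S with j ≡ᵇ j | ≡⇒≡ᵇ j j refl
... | true | _ = refl

tsubst-tv-< : ∀ {j k} S → k < j → tsubst j S (tv k) ≡ tv k
tsubst-tv-< {j} {k} S k<j with k ≡ᵇ j | ≡ᵇ⇒≡ k j | k <ᵇ j | <⇒<ᵇ k<j
... | true  | k≡j | _    | _ = contradiction (k≡j _) (<⇒≢ k<j)
... | false | _   | true | _ = refl

tsubst-tv-> : ∀ {j k} S → j ≤ k → tsubst j S (tv (suc k)) ≡ tv k
tsubst-tv-> {j} {k} S j≤k with suc k ≡ᵇ j | ≡ᵇ⇒≡ (suc k) j | suc k <ᵇ j | <ᵇ⇒< (suc k) j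
... | true  | k+1≡j | _     | _   = contradiction j≤k (subst (λ i → ¬ i ≤ k) (k+1≡j _) 1+n≰n)
... | false | _     | true  | k<j = contradiction (≤-trans j≤k (n≤1+n k)) (<⇒≱ (k<j _))
... | false | _     | false | _   = refl

shift-shift : ∀ A {c d} → c ≤ d → shift (suc d) (shift c A) ≡ shift c (shift d A)
shift-shift (tv k) {c} {d} c≤d with k <? c | k <? d
... | yes k<c | _ = begin
  shift (suc d) (shift c (tv k)) ≡⟨ cong (shift (suc d)) (shift-tv-< k<c) ⟩
  shift (suc d) (tv k)           ≡⟨ shift-tv-< (m<n⇒m<1+n (<-≤-trans k<c c≤d)) ⟩
  tv k                           ≡⟨ shift-tv-< k<c ⟨
  shift c (tv k)                 ≡⟨ cong (shift c) (shift-tv-< (<-≤-trans k<c c≤d)) ⟨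
  shift c (shift d (tv k))       ∎
... | no k≮c | yes k<d = begin
  shift (suc d) (shift c (tv k)) ≡⟨ cong (shift (suc d)) (shift-tv-≥ (≮⇒≥ k≮c)) ⟩
  shift (suc d) (tv (suc k))     ≡⟨ shift-tv-< (s≤s k<d) ⟩
  tv (suc k)                     ≡⟨ shift-tv-≥ (≮⇒≥ k≮c) ⟨
  shift c (tv k)                 ≡⟨ cong (shift c) (shift-tv-< k<d) ⟨
  shift c (shift d (tv k))       ∎
... | no k≮c | no k≮d = begin
  shift (suc d) (shift c (tv k)) ≡⟨ cong (shift (suc d)) (shift-tv-≥ (≮⇒≥ k≮c)) ⟩
  shift (suc d) (tv (suc k))     ≡⟨ shift-tv-≥ (s≤s (≮⇒≥ k≮d)) ⟩
  tv (suc (suc k))               ≡⟨ shift-tv-≥ (≤-trans (≮⇒≥ k≮c) (n≤1+n k)) ⟨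
  shift c (tv (suc k))           ≡⟨ cong (shift c) (shift-tv-≥ (≮⇒≥ k≮d)) ⟨
  shift c (shift d (tv k))       ∎
shift-shift ⊥'      c≤d = refl
shift-shift (A ⇒ B) c≤d = cong₂ _⇒_ (shift-shift A c≤d) (shift-shift B c≤d)
shift-shift (∀' A)  c≤d = cong ∀' (shift-shift A (s≤s c≤d))

tsubst-shift : ∀ A j S → tsubst j S (shift j A) ≡ A
tsubst-shift (tv k) j S with k <? j
... | yes k<j = trans (cong (tsubst j S) (shift-tv-< k<j)) (tsubst-tv-< S k<j)
... | no k≮j  = trans (cong (tsubst j S) (shift-tv-≥ (≮⇒≥ k≮j))) (tsubst-tv-> S (≮⇒≥ k≮j))
tsubst-shift ⊥'      j S = refl
tsubst-shift (A ⇒ B) j S = cong₂ _⇒_ (tsubst-shift A j S) (tsubst-shift B j S)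
tsubst-shift (∀' A)  j S = cong ∀' (tsubst-shift A (suc j) (shift 0 S))

shift-tsubst : ∀ A {c j} S → c ≤ j →
  shift c (tsubst j S A) ≡ tsubst (suc j) (shift c S) (shift c A)
shift-tsubst (tv k) {c} {j} S c≤j with <-cmp k j
... | tri≈ _ refl _ = begin
  shift c (tsubst k S (tv k))                  ≡⟨ cong (shift c) (tsubst-tv-≡ k S) ⟩
  shift c S                                    ≡⟨ tsubst-tv-≡ (suc k) (shift c S) ⟨
  tsubst (suc k) (shift c S) (tv (suc k))      ≡⟨ cong (tsubst (suc k) (shift c S)) (shift-tv-≥ c≤j) ⟨
  tsubst (suc k) (shift c S) (shift c (tv k))  ∎
... | tri< k<j _ _ with k <? c
...   | yes k<c = begin
  shift c (tsubst j S (tv k))                  ≡⟨ cong (shift c) (tsubst-tv-< S k<j) ⟩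
  shift c (tv k)                               ≡⟨ shift-tv-< k<c ⟩
  tv k                                         ≡⟨ tsubst-tv-< (shift c S) (m<n⇒m<1+n k<j) ⟨
  tsubst (suc j) (shift c S) (tv k)            ≡⟨ cong (tsubst (suc j) (shift c S)) (shift-tv-< k<c) ⟨
  tsubst (suc j) (shift c S) (shift c (tv k))  ∎
...   | no k≮c = begin
  shift c (tsubst j S (tv k))                  ≡⟨ cong (shift c) (tsubst-tv-< S k<j) ⟩
  shift c (tv k)                               ≡⟨ shift-tv-≥ (≮⇒≥ k≮c) ⟩
  tv (suc k)                                   ≡⟨ tsubst-tv-< (shift c S) (s≤s k<j) ⟨
  tsubst (suc j) (shift c S) (tv (suc k))      ≡⟨ cong (tsubst (suc j) (shift c S)) (shift-tv-≥ (≮⇒≥ k≮c)) ⟨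
  tsubst (suc j) (shift c S) (shift c (tv k))  ∎
shift-tsubst (tv (suc k)) {c} {j} S c≤j | tri> _ _ (s≤s j≤k) = begin
  shift c (tsubst j S (tv (suc k)))                  ≡⟨ cong (shift c) (tsubst-tv-> S j≤k) ⟩
  shift c (tv k)                                     ≡⟨ shift-tv-≥ (≤-trans c≤j j≤k) ⟩
  tv (suc k)                                         ≡⟨ tsubst-tv-> (shift c S) (s≤s j≤k) ⟨
  tsubst (suc j) (shift c S) (tv (suc (suc k)))      ≡⟨ cong (tsubst (suc j) (shift c S)) c-shifts-k+1 ⟨
  tsubst (suc j) (shift c S) (shift c (tv (suc k)))  ∎
  where c-shifts-k+1 = shift-tv-≥ (≤-trans c≤j (≤-trans j≤k (n≤1+n k)))
shift-tsubst ⊥'      S c≤j = refl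
shift-tsubst (A ⇒ B) S c≤j = cong₂ _⇒_ (shift-tsubst A S c≤j) (shift-tsubst B S c≤j)
shift-tsubst (∀' A) {c} {j} S c≤j = cong ∀' (begin
  shift (suc c) (tsubst (suc j) (shift 0 S) A)
    ≡⟨ shift-tsubst A (shift 0 S) (s≤s c≤j) ⟩
  tsubst (suc (suc j)) (shift (suc c) (shift 0 S)) (shift (suc c) A)
    ≡⟨ cong (λ S′ → tsubst (suc (suc j)) S′ (shift (suc c) A)) (shift-shift S z≤n) ⟩
  tsubst (suc (suc j)) (shift 0 (shift c S)) (shift (suc c) A) ∎)

tsubst-tsubst : ∀ A {i j} S U → i ≤ j →
  tsubst j S (tsubst i U A) ≡ tsubst i (tsubst j S U) (tsubst (suc j) (shift i S) A)
tsubst-tsubst (tv k) {i} {j} S U i≤j with <-cmp k i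
... | tri≈ _ refl _ = begin
  tsubst j S (tsubst k U (tv k))                         ≡⟨ cong (tsubst j S) (tsubst-tv-≡ k U) ⟩
  tsubst j S U                                           ≡⟨ tsubst-tv-≡ k _ ⟨
  tsubst k (tsubst j S U) (tv k)                         ≡⟨ cong (tsubst k _) (tsubst-tv-< (shift k S) (s≤s i≤j)) ⟨
  tsubst k (tsubst j S U) (tsubst (suc j) (shift k S) (tv k)) ∎
... | tri< k<i _ _ = begin
  tsubst j S (tsubst i U (tv k))                         ≡⟨ cong (tsubst j S) (tsubst-tv-< U k<i) ⟩
  tsubst j S (tv k)                                      ≡⟨ tsubst-tv-< S (<-≤-trans k<i i≤j) ⟩
  tv k                                                   ≡⟨ tsubst-tv-< _ k<i ⟨
  tsubst i (tsubst j S U) (tv k)                         ≡⟨ cong (tsubst i _) k-below ⟨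
  tsubst i (tsubst j S U) (tsubst (suc j) (shift i S) (tv k)) ∎
  where k-below = tsubst-tv-< (shift i S) (m<n⇒m<1+n (<-≤-trans k<i i≤j))
tsubst-tsubst (tv (suc k)) {i} {j} S U i≤j | tri> _ _ (s≤s i≤k) with <-cmp k j
... | tri≈ _ refl _ = begin
  tsubst k S (tsubst i U (tv (suc k)))                   ≡⟨ cong (tsubst k S) (tsubst-tv-> U i≤k) ⟩
  tsubst k S (tv k)                                      ≡⟨ tsubst-tv-≡ k S ⟩
  S                                                      ≡⟨ tsubst-shift S i _ ⟨
  tsubst i (tsubst k S U) (shift i S)                    ≡⟨ cong (tsubst i _) (tsubst-tv-≡ (suc k) (shift i S)) ⟨
  tsubst i (tsubst k S U) (tsubst (suc k) (shift i S) (tv (suc k))) ∎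
... | tri< k<j _ _ = begin
  tsubst j S (tsubst i U (tv (suc k)))                   ≡⟨ cong (tsubst j S) (tsubst-tv-> U i≤k) ⟩
  tsubst j S (tv k)                                      ≡⟨ tsubst-tv-< S k<j ⟩
  tv k                                                   ≡⟨ tsubst-tv-> _ i≤k ⟨
  tsubst i (tsubst j S U) (tv (suc k))                   ≡⟨ cong (tsubst i _) (tsubst-tv-< (shift i S) (s≤s k<j)) ⟨
  tsubst i (tsubst j S U) (tsubst (suc j) (shift i S) (tv (suc k))) ∎
tsubst-tsubst (tv (suc (suc k))) {i} {j} S U i≤j | tri> _ _ (s≤s i≤k+1) | tri> _ _ (s≤s j≤k) = begin
  tsubst j S (tsubst i U (tv (suc (suc k))))             ≡⟨ cong (tsubst j S) (tsubst-tv-> U i≤k+1) ⟩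
  tsubst j S (tv (suc k))                                ≡⟨ tsubst-tv-> S j≤k ⟩
  tv k                                                   ≡⟨ tsubst-tv-> _ (≤-trans i≤j j≤k) ⟨
  tsubst i (tsubst j S U) (tv (suc k))                   ≡⟨ cong (tsubst i _) (tsubst-tv-> (shift i S) (s≤s j≤k)) ⟨
  tsubst i (tsubst j S U) (tsubst (suc j) (shift i S) (tv (suc (suc k)))) ∎
tsubst-tsubst ⊥'      S U i≤j = refl
tsubst-tsubst (A ⇒ B) S U i≤j = cong₂ _⇒_ (tsubst-tsubst A S U i≤j) (tsubst-tsubst B S U i≤j)
tsubst-tsubst (∀' A) {i} {j} S U i≤j = cong ∀' (begin
  tsubst (suc j) (shift 0 S) (tsubst (suc i) (shift 0 U) A)
    ≡⟨ tsubst-tsubst A (shift 0 S) (shift 0 U) (s≤s i≤j) ⟩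
  tsubst (suc i) (tsubst (suc j) (shift 0 S) (shift 0 U)) (tsubst (suc (suc j)) (shift (suc i) (shift 0 S)) A)
    ≡⟨ cong₂ (λ U′ S′ → tsubst (suc i) U′ (tsubst (suc (suc j)) S′ A)) (shift-tsubst U S z≤n) (sym (shift-shift S z≤n)) ⟨
  tsubst (suc i) (shift 0 (tsubst j S U)) (tsubst (suc (suc j)) (shift 0 (shift i S)) A) ∎)

map-shift-tsubst : ∀ {n} j S (Γ : Vec Ty n) →
  map (shift 0) (map (tsubst j S) Γ) ≡ map (tsubst (suc j) (shift 0 S)) (map (shift 0) Γ)
map-shift-tsubst j S Γ = begin
  map (shift 0) (map (tsubst j S) Γ)                   ≡⟨ map-∘ (shift 0) (tsubst j S) Γ ⟨
  map (shift 0 ∘ tsubst j S) Γ                         ≡⟨ map-cong (λ A → shift-tsubst A S z≤n) Γ ⟩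
  map (tsubst (suc j) (shift 0 S) ∘ shift 0) Γ         ≡⟨ map-∘ (tsubst (suc j) (shift 0 S)) (shift 0) Γ ⟩
  map (tsubst (suc j) (shift 0 S)) (map (shift 0) Γ)   ∎

⊢-tsubst : ∀ {n} {Γ : Vec Ty n} {t A} j S → Γ ⊢ t ∶ A → map (tsubst j S) Γ ⊢ t ∶ tsubst j S A
⊢-tsubst {Γ = Γ} j S (ax i) = subst (λ C → map (tsubst j S) Γ ⊢ var i ∶ C) (lookup-map i (tsubst j S) Γ) (ax i)
⊢-tsubst j S (⇒I d)   = ⇒I (⊢-tsubst j S d)
⊢-tsubst j S (⇒E d e) = ⇒E (⊢-tsubst j S d) (⊢-tsubst j S e)
⊢-tsubst {Γ = Γ} {t} j S (∀I d) =
  ∀I (subst (λ Δ → Δ ⊢ t ∶ _) (sym (map-shift-tsubst j S Γ)) (⊢-tsubst (suc j) (shift 0 S) d))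
⊢-tsubst {Γ = Γ} {t} j S (∀E {A} U d) =
  subst (λ C → map (tsubst j S) Γ ⊢ t ∶ C) (sym (tsubst-tsubst A S U z≤n)) (∀E (tsubst j S U) (⊢-tsubst j S d))

∀ⁿ : ℕ → Ty → Ty
∀ⁿ zero    A = A
∀ⁿ (suc k) A = ∀' (∀ⁿ k A)

shiftⁿ : ℕ → Ty → Ty
shiftⁿ zero    A = A
shiftⁿ (suc k) A = shiftⁿ k (shift 0 A)

shiftⁿ-ctx : ∀ {n} → ℕ → Vec Ty n → Vec Ty n
shiftⁿ-ctx zero    Γ = Γ
shiftⁿ-ctx (suc k) Γ = shiftⁿ-ctx k (map (shift 0) Γ)

shiftⁿ-ctx-map : ∀ {n} k (Γ : Vec Ty n) → shiftⁿ-ctx k Γ ≡ map (shiftⁿ k) Γ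
shiftⁿ-ctx-map zero    Γ = sym (map-id Γ)
shiftⁿ-ctx-map (suc k) Γ = trans (shiftⁿ-ctx-map k (map (shift 0) Γ)) (sym (map-∘ (shiftⁿ k) (shift 0) Γ))

shiftⁿ-shift : ∀ k A c → shiftⁿ k (shift c A) ≡ shift (c + k) (shiftⁿ k A)
shiftⁿ-shift zero A c = cong (λ m → shift m A) (sym (+-identityʳ c))
shiftⁿ-shift (suc k) A c = begin
  shiftⁿ k (shift 0 (shift c A))        ≡⟨ cong (shiftⁿ k) (shift-shift A z≤n) ⟨
  shiftⁿ k (shift (suc c) (shift 0 A))  ≡⟨ shiftⁿ-shift k (shift 0 A) (suc c) ⟩
  shift (suc c + k) (shiftⁿ (suc k) A)  ≡⟨ cong (λ m → shift m (shiftⁿ (suc k) A)) (+-suc c k) ⟨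
  shift (c + suc k) (shiftⁿ (suc k) A)  ∎

tsubst-shiftⁿ : ∀ k A S → tsubst k S (shiftⁿ (suc k) A) ≡ shiftⁿ k A
tsubst-shiftⁿ k A S = trans (cong (tsubst k S) (shiftⁿ-shift k A 0)) (tsubst-shift (shiftⁿ k A) k S)

tsubst-shiftⁿ-ctx : ∀ {n} k S (Γ : Vec Ty n) → map (tsubst k S) (shiftⁿ-ctx (suc k) Γ) ≡ shiftⁿ-ctx k Γ
tsubst-shiftⁿ-ctx k S Γ = begin
  map (tsubst k S) (shiftⁿ-ctx (suc k) Γ)        ≡⟨ cong (map (tsubst k S)) (shiftⁿ-ctx-map (suc k) Γ) ⟩
  map (tsubst k S) (map (shiftⁿ (suc k)) Γ)      ≡⟨ map-∘ (tsubst k S) (shiftⁿ (suc k)) Γ ⟨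
  map (tsubst k S ∘ shiftⁿ (suc k)) Γ            ≡⟨ map-cong (λ A → tsubst-shiftⁿ k A S) Γ ⟩
  map (shiftⁿ k) Γ                               ≡⟨ shiftⁿ-ctx-map k Γ ⟨
  shiftⁿ-ctx k Γ                                 ∎

tsubst-∀ⁿ : ∀ k j S C → tsubst j S (∀ⁿ k C) ≡ ∀ⁿ k (tsubst (j + k) (shiftⁿ k S) C)
tsubst-∀ⁿ zero    j S C = cong (λ m → tsubst m S C) (sym (+-identityʳ j))
tsubst-∀ⁿ (suc k) j S C = cong ∀' (trans (tsubst-∀ⁿ k (suc j) (shift 0 S) C)
  (cong (λ m → ∀ⁿ k (tsubst m (shiftⁿ (suc k) S) C)) (sym (+-suc j k))))

infix 4 _⊑_
data _⊑_ (A : Ty) : Ty → Set where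
  ⊑-refl : A ⊑ A
  ⊑-∀E   : ∀ {K} → A ⊑ ∀' K → (S : Ty) → A ⊑ K [ S ]

⊑-tsubst : ∀ {A C} j S → A ⊑ C → tsubst j S A ⊑ tsubst j S C
⊑-tsubst j S ⊑-refl = ⊑-refl
⊑-tsubst {A} j S (⊑-∀E {K} p U) =
  subst (tsubst j S A ⊑_) (sym (tsubst-tsubst K S U z≤n)) (⊑-∀E (⊑-tsubst j S p) (tsubst j S U))

⊑-rigid : ∀ {A C} → (∀ {K} → A ≢ ∀' K) → A ⊑ C → C ≡ A
⊑-rigid A-not-∀ ⊑-refl = refl
⊑-rigid A-not-∀ (⊑-∀E p S) = contradiction (sym (⊑-rigid A-not-∀ p)) A-not-∀

-- Derivations whose last rule is the one dictated by the shape of the term.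
infix 4 _⊢ₛ_∶_
data _⊢ₛ_∶_ {n : ℕ} (Γ : Vec Ty n) : Tm n → Ty → Set where
  ax : (i : Fin n) → Γ ⊢ₛ var i ∶ lookup Γ i
  ⇒I : ∀ {A B t} → (A ∷ Γ) ⊢ t ∶ B → Γ ⊢ₛ lam t ∶ A ⇒ B
  ⇒E : ∀ {A B t u} → Γ ⊢ t ∶ A ⇒ B → Γ ⊢ u ∶ A → Γ ⊢ₛ app t u ∶ B

⊢ₛ-tsubst : ∀ {n} {Γ : Vec Ty n} {t A} j S → Γ ⊢ₛ t ∶ A → map (tsubst j S) Γ ⊢ₛ t ∶ tsubst j S A
⊢ₛ-tsubst {Γ = Γ} j S (ax i) = subst (λ C → map (tsubst j S) Γ ⊢ₛ var i ∶ C) (lookup-map i (tsubst j S) Γ) (ax i)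
⊢ₛ-tsubst j S (⇒I d)   = ⇒I (⊢-tsubst j S d)
⊢ₛ-tsubst j S (⇒E d e) = ⇒E (⊢-tsubst j S d) (⊢-tsubst j S e)

data Generation {n : ℕ} (Γ : Vec Ty n) (t : Tm n) (C : Ty) : Set where
  generated : ∀ k {C₀ C₁} → C ≡ ∀ⁿ k C₁ → C₀ ⊑ C₁ → shiftⁿ-ctx k Γ ⊢ₛ t ∶ C₀ → Generation Γ t C

-- A ∀-elimination directly after a ∀-introduction is absorbed by substituting into the premise.
generation : ∀ {n} {Γ : Vec Ty n} {t C} → Γ ⊢ t ∶ C → Generation Γ t C
generation (ax i)   = generated 0 refl ⊑-refl (ax i)
generation (⇒I d)   = generated 0 refl ⊑-refl (⇒I d)
generation (⇒E d e) = generated 0 refl ⊑-refl (⇒E d e)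
generation (∀I d) with generation d
... | generated k eq p h = generated (suc k) (cong ∀' eq) p h
generation (∀E S d) with generation d
... | generated zero    refl p h = generated 0 refl (⊑-∀E p S) h
... | generated (suc k) {C₀} {C₁} refl p h =
  generated k (tsubst-∀ⁿ k 0 S C₁) (⊑-tsubst k Sₖ p)
    (subst (λ Δ → Δ ⊢ₛ _ ∶ tsubst k Sₖ C₀) (tsubst-shiftⁿ-ctx k Sₖ _) (⊢ₛ-tsubst k Sₖ h))
  where Sₖ = shiftⁿ k S

lam-typing : ∀ {n} {Γ : Vec Ty n} {s C} → Γ ⊢ lam s ∶ C →
  ∃[ k ] ∃[ A ] ∃[ B ] C ≡ ∀ⁿ k (A ⇒ B) × (A ∷ shiftⁿ-ctx k Γ) ⊢ s ∶ B
lam-typing d with generation d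
... | generated k refl p (⇒I e) = k , _ , _ , cong (∀ⁿ k) (⊑-rigid (λ ()) p) , e

-- A Kripke model on (ℕ, ≤)

-- The up-sets [n, ∞) and ∅ of worlds, over which the quantifier of the model ranges.
above : Maybe ℕ → Pred ℕ 0ℓ
above (just n) w = n ≤ w
above nothing  w = ⊥

above-mono : ∀ d {v w} → v ≤ w → above d v → above d w
above-mono (just n) v≤w n≤v = ≤-trans n≤v v≤w

above-stable : ∀ d w → Stable (above d w)
above-stable nothing  w ¬¬⊥ = ¬¬⊥ id
above-stable (just n) w     = decidable-stable (n ≤? w)

UpClosed : Pred ℕ 0ℓ → Set
UpClosed X = ∀ {v w} → v ≤ w → X v → X w

up-closed-definable : ∀ X → UpClosed X → ¬ ¬ (∃[ d ] X ≐ above d)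
up-closed-definable X up = ¬¬-excluded-middle >>= λ where
    (no  X-empty)   → return (nothing , (λ {w} x → X-empty (w , x)) , λ ())
    (yes (v , x))   → ¬¬-map (λ (n , X≐n) → just n , X≐n) (least v x)
  where
  open RawMonad ¬¬-Monad
  minimal : ∀ v w → ¬ X v → X w → suc v ≤ w
  minimal v w ¬x xw with v <? w
  ... | yes v<w = v<w
  ... | no  v≮w = contradiction (up (≮⇒≥ v≮w) xw) ¬x
  least : ∀ v → X v → ¬ ¬ (∃[ n ] X ≐ above (just n))
  least zero x = return (0 , (λ {_} _ → z≤n) , (λ {_} 0≤w → up 0≤w x))
  least (suc v) x = ¬¬-excluded-middle >>= λ where
    (yes x′) → least v x′
    (no ¬x′) → return (suc v , (λ {w} xw → minimal v w ¬x′ xw) , (λ {_} v<w → up v<w x))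

Val : Set
Val = ℕ → Maybe ℕ

infixr 5 _∷ᵛ_
_∷ᵛ_ : Maybe ℕ → Val → Val
(d ∷ᵛ ρ) zero    = d
(d ∷ᵛ ρ) (suc k) = ρ k

insert : ℕ → Maybe ℕ → Val → Val
insert zero    d ρ = d ∷ᵛ ρ
insert (suc j) d ρ = ρ 0 ∷ᵛ insert j d (ρ ∘ suc)

insert-≡ : ∀ j d ρ → insert j d ρ j ≡ d
insert-≡ zero    d ρ = refl
insert-≡ (suc j) d ρ = insert-≡ j d (ρ ∘ suc)

insert-< : ∀ {j k} d ρ → k < j → insert j d ρ k ≡ ρ k
insert-< {suc j} {zero}  d ρ _         = refl
insert-< {suc j} {suc k} d ρ (s≤s k<j) = insert-< d (ρ ∘ suc) k<j

insert-≥ : ∀ {j k} d ρ → j ≤ k → insert j d ρ (suc k) ≡ ρ k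
insert-≥ {zero}  {k}     d ρ _         = refl
insert-≥ {suc j} {suc k} d ρ (s≤s j≤k) = insert-≥ d (ρ ∘ suc) j≤k

infixr 7 _⇛_
_⇛_ : Pred ℕ 0ℓ → Pred ℕ 0ℓ → Pred ℕ 0ℓ
(X ⇛ Y) w = ∀ v → w ≤ v → X v → Y v

⟦_⟧ : Ty → Val → Pred ℕ 0ℓ
⟦ tv k ⟧  ρ   = above (ρ k)
⟦ ⊥' ⟧    ρ _ = ⊥
⟦ A ⇒ B ⟧ ρ   = ⟦ A ⟧ ρ ⇛ ⟦ B ⟧ ρ
⟦ ∀' A ⟧  ρ w = (d : Maybe ℕ) → ⟦ A ⟧ (d ∷ᵛ ρ) w

⇛-cong : ∀ {X X′ Y Y′} → X ≐ X′ → Y ≐ Y′ → (X ⇛ Y) ≐ (X′ ⇛ Y′)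
⇛-cong (X⊆X′ , X′⊆X) (Y⊆Y′ , Y′⊆Y) =
  (λ f v w≤v x → Y⊆Y′ (f v w≤v (X′⊆X x))) , (λ f v w≤v x → Y′⊆Y (f v w≤v (X⊆X′ x)))

Π-cong : ∀ {F G : Maybe ℕ → Pred ℕ 0ℓ} → (∀ d → F d ≐ G d) → (λ w → ∀ d → F d w) ≐ (λ w → ∀ d → G d w)
Π-cong F≐G = (λ f d → proj₁ (F≐G d) (f d)) , (λ g d → proj₂ (F≐G d) (g d))

≡⇒≐ : ∀ {X Y : Pred ℕ 0ℓ} → X ≡ Y → X ≐ Y
≡⇒≐ refl = ≐-refl

⟦⟧-shift : ∀ A c d ρ → ⟦ shift c A ⟧ (insert c d ρ) ≐ ⟦ A ⟧ ρ
⟦⟧-shift (tv k) c d ρ with k <? c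
... | yes k<c rewrite shift-tv-< k<c = ≡⇒≐ (cong above (insert-< d ρ k<c))
... | no  k≮c rewrite shift-tv-≥ (≮⇒≥ k≮c) = ≡⇒≐ (cong above (insert-≥ d ρ (≮⇒≥ k≮c)))
⟦⟧-shift ⊥'      c d ρ = ≐-refl
⟦⟧-shift (A ⇒ B) c d ρ = ⇛-cong (⟦⟧-shift A c d ρ) (⟦⟧-shift B c d ρ)
⟦⟧-shift (∀' A)  c d ρ = Π-cong λ d′ → ⟦⟧-shift A (suc c) d (d′ ∷ᵛ ρ)

⟦⟧-tsubst : ∀ A j S ρ d → ⟦ S ⟧ ρ ≐ above d → ⟦ tsubst j S A ⟧ ρ ≐ ⟦ A ⟧ (insert j d ρ)
⟦⟧-tsubst (tv k) j S ρ d S≐d with <-cmp k j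
... | tri≈ _ refl _ rewrite tsubst-tv-≡ k S | insert-≡ k d ρ = S≐d
... | tri< k<j _ _  rewrite tsubst-tv-< S k<j = ≡⇒≐ (cong above (sym (insert-< d ρ k<j)))
⟦⟧-tsubst (tv (suc k)) j S ρ d S≐d | tri> _ _ (s≤s j≤k)
  rewrite tsubst-tv-> S j≤k = ≡⇒≐ (cong above (sym (insert-≥ d ρ j≤k)))
⟦⟧-tsubst ⊥'      j S ρ d S≐d = ≐-refl
⟦⟧-tsubst (A ⇒ B) j S ρ d S≐d = ⇛-cong (⟦⟧-tsubst A j S ρ d S≐d) (⟦⟧-tsubst B j S ρ d S≐d)
⟦⟧-tsubst (∀' A)  j S ρ d S≐d =
  Π-cong λ d′ → ⟦⟧-tsubst A (suc j) (shift 0 S) (d′ ∷ᵛ ρ) d (≐-trans (⟦⟧-shift S 0 d′ ρ) S≐d)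

⟦⟧-mono : ∀ A ρ → UpClosed (⟦ A ⟧ ρ)
⟦⟧-mono (tv k)  ρ v≤w x = above-mono (ρ k) v≤w x
⟦⟧-mono (A ⇒ B) ρ v≤w f u w≤u = f u (≤-trans v≤w w≤u)
⟦⟧-mono (∀' A)  ρ v≤w f d = ⟦⟧-mono A (d ∷ᵛ ρ) v≤w (f d)

⟦⟧-stable : ∀ A ρ w → Stable (⟦ A ⟧ ρ w)
⟦⟧-stable (tv k)  ρ w ¬¬x = above-stable (ρ k) w ¬¬x
⟦⟧-stable ⊥'      ρ w ¬¬x = ¬¬x id
⟦⟧-stable (A ⇒ B) ρ w ¬¬f v w≤v a = ⟦⟧-stable B ρ v (¬¬-map (λ f → f v w≤v a) ¬¬f)
⟦⟧-stable (∀' A)  ρ w ¬¬f d = ⟦⟧-stable A (d ∷ᵛ ρ) w (¬¬-map (λ f → f d) ¬¬f)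

-- ∀-elimination needs ⟦ S ⟧ ρ to be one of the sets the quantifier ranges over, which holds only up to ¬¬.
sound : ∀ {n} {Γ : Vec Ty n} {t A} → Γ ⊢ t ∶ A → ∀ ρ {w} → All (λ B → ⟦ B ⟧ ρ w) Γ → ⟦ A ⟧ ρ w
sound (ax i)   ρ γ = lookup⁺ γ i
sound (⇒I d)   ρ γ v w≤v a = sound d ρ (a ∷ All.map (λ {B} → ⟦⟧-mono B ρ w≤v) γ)
sound (⇒E d e) ρ γ = sound d ρ γ _ ≤-refl (sound e ρ γ)
sound (∀I d)   ρ γ d′ = sound d (d′ ∷ᵛ ρ) (map⁺ (All.map (λ {B} → proj₂ (⟦⟧-shift B 0 d′ ρ)) γ))
sound (∀E {A} S d) ρ {w} γ = ⟦⟧-stable (A [ S ]) ρ w (¬¬-map instantiate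
  (up-closed-definable (⟦ S ⟧ ρ) (⟦⟧-mono S ρ)))
  where
  instantiate : ∃[ d ] ⟦ S ⟧ ρ ≐ above d → ⟦ A [ S ] ⟧ ρ w
  instantiate (d′ , S≐d′) = proj₂ (⟦⟧-tsubst A 0 S ρ d′ S≐d′) (sound d ρ γ d′)

P-refuted : ∀ ρ w → ¬ ⟦ P ⟧ ρ w
P-refuted ρ w p = 1+n≰n (p (just (suc w)) nothing w ≤-refl premise)
  where
  premise : ∀ v → w ≤ v → (above (just (suc w)) ⇛ above nothing) v → suc w ≤ v
  premise v w≤v ¬above = ⊥-elim (¬above (suc v) (n≤1+n v) (s≤s w≤v))

D-valid : ∀ ρ w → ⟦ D ⟧ ρ w
D-valid ρ w _ _ _ d _ _ x v v′≤v _ = above-mono d v′≤v x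

data DOrTyVar : Ty → Set where
  isD     : DOrTyVar D
  isTyVar : ∀ j → DOrTyVar (tv j)

DOrTyVar-shift : ∀ {A} → DOrTyVar A → DOrTyVar (shift 0 A)
DOrTyVar-shift isD         = isD
DOrTyVar-shift (isTyVar j) = isTyVar (suc j)

All-DOrTyVar-shiftⁿ-ctx : ∀ {n} k {Γ : Vec Ty n} → All DOrTyVar Γ → All DOrTyVar (shiftⁿ-ctx k Γ)
All-DOrTyVar-shiftⁿ-ctx zero    g = g
All-DOrTyVar-shiftⁿ-ctx (suc k) g = All-DOrTyVar-shiftⁿ-ctx k (map⁺ (All.map DOrTyVar-shift g))

-- In the model with every type variable true, D holds and P fails everywhere, so Q holds at world 0.
Q⇒P-uninhabited : ∀ {n} {Γ : Vec Ty n} {u} → All DOrTyVar Γ → ¬ Γ ⊢ u ∶ Q ⇒ P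
Q⇒P-uninhabited g d = P-refuted ρ 0 (sound d ρ (All.map hyp g) 0 z≤n Q-valid)
  where
  ρ : Val
  ρ _ = just 0
  hyp : ∀ {A} → DOrTyVar A → ⟦ A ⟧ ρ 0
  hyp isD         = D-valid ρ 0
  hyp (isTyVar j) = z≤n
  Q-valid : ⟦ Q ⟧ ρ 0
  Q-valid v _ p = ⊥-elim (P-refuted ρ v p)

var-typing : ∀ {n} {Γ : Vec Ty n} {i C} → All DOrTyVar Γ → Γ ⊢ var i ∶ C →
  ∃[ k ] C ≡ ∀ⁿ k (lookup (shiftⁿ-ctx k Γ) i)
var-typing {i = i} g d with generation d
... | generated k refl p (ax .i) = k , cong (∀ⁿ k) (⊑-rigid (not-∀ (lookup⁺ (All-DOrTyVar-shiftⁿ-ctx k g) i)) p)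
  where
  not-∀ : ∀ {A K} → DOrTyVar A → A ≢ ∀' K
  not-∀ isD         ()
  not-∀ (isTyVar j) ()

DOrTyVar-domain : ∀ {A B G} → DOrTyVar G → A ⇒ B ≡ G → A ≡ Q ⇒ P
DOrTyVar-domain isD refl = refl

-- The head of a neutral application is a variable whose type must be D, so its first argument would inhabit Q ⇒ P.
app-untypable : ∀ {n} {Γ : Vec Ty n} {m u C} → All DOrTyVar Γ → Neutral m → ¬ Γ ⊢ app m u ∶ C
head-untypable : ∀ {n} {Γ : Vec Ty n} {m u A B} → All DOrTyVar Γ → Neutral m →
  Γ ⊢ m ∶ A ⇒ B → ¬ Γ ⊢ u ∶ A

app-untypable g m d with generation d
... | generated k _ _ (⇒E dm du) = head-untypable (All-DOrTyVar-shiftⁿ-ctx k g) m dm du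

head-untypable g (var i) dm du with var-typing g dm
... | zero  , eq = Q⇒P-uninhabited g (subst (λ A → _ ⊢ _ ∶ A) (DOrTyVar-domain (lookup⁺ g i) eq) du)
... | suc _ , ()
head-untypable g (app m _) dm _ = app-untypable g m dm

tyvar-inhabitants : ∀ {s} → Normal s → (tv 0 ∷ tv 0 ∷ D ∷ []) ⊢ s ∶ tv 0 →
  s ≡ var (suc zero) ⊎ s ≡ var zero
tyvar-inhabitants (ne (var zero))             _ = inj₂ refl
tyvar-inhabitants (ne (var (suc zero)))       _ = inj₁ refl
tyvar-inhabitants (ne (var (suc (suc zero)))) d with var-typing (isTyVar 0 ∷ isTyVar 0 ∷ isD ∷ []) d
... | zero  , ()
... | suc _ , ()
tyvar-inhabitants (ne (app m _)) d = ⊥-elim (app-untypable (isTyVar 0 ∷ isTyVar 0 ∷ isD ∷ []) m d)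
tyvar-inhabitants (lam _) d with lam-typing d
... | zero  , _ , _ , () , _
... | suc _ , _ , _ , () , _

endo-inhabitants : ∀ {s} → Normal s → (tv 0 ∷ D ∷ []) ⊢ s ∶ tv 0 ⇒ tv 0 →
  s ≡ lam (var (suc zero)) ⊎ s ≡ lam (var zero)
endo-inhabitants (ne (var i)) d with var-typing (isTyVar 0 ∷ isD ∷ []) d
endo-inhabitants (ne (var zero))       d | zero  , ()
endo-inhabitants (ne (var (suc zero))) d | zero  , ()
endo-inhabitants (ne (var _))          d | suc _ , ()
endo-inhabitants (ne (app m _)) d = ⊥-elim (app-untypable (isTyVar 0 ∷ isD ∷ []) m d)
endo-inhabitants (lam s) d with lam-typing d
... | zero  , _ , _ , refl , e = Sum.map (cong lam) (cong lam) (tyvar-inhabitants s e)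
... | suc _ , _ , _ , ()   , _

B-inhabitants : ∀ {s} → Normal s → (D ∷ []) ⊢ s ∶ B →
  s ≡ lam (lam (var (suc zero))) ⊎ s ≡ lam (lam (var zero))
B-inhabitants (ne (var zero)) d with var-typing (isD ∷ []) d
... | zero        , ()
... | suc zero    , ()
... | suc (suc _) , ()
B-inhabitants (ne (app m _)) d = ⊥-elim (app-untypable (isD ∷ []) m d)
B-inhabitants (lam s) d with lam-typing d
... | zero        , _ , _ , ()   , _
... | suc zero    , _ , _ , refl , e = Sum.map (cong lam) (cong lam) (endo-inhabitants s e)
... | suc (suc _) , _ , _ , ()   , _

D⇒B-inhabitants : ∀ {t} → Normal t → ⊢ t ∶ D ⇒ B → t ≡ λT ⊎ t ≡ λF
D⇒B-inhabitants (ne (var ()))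
D⇒B-inhabitants (ne (app m _)) d = ⊥-elim (app-untypable [] m d)
D⇒B-inhabitants (lam s) d with lam-typing d
... | zero  , _ , _ , refl , e = Sum.map (cong lam) (cong lam) (B-inhabitants s e)
... | suc _ , _ , _ , ()   , _

mainTheorem7 : (t : Tm 0) → Normal t →
    ((⊢ t ∶ D ⇒ B) → (t ≡ λT ⊎ t ≡ λF)) × ((t ≡ λT ⊎ t ≡ λF) → (⊢ t ∶ D ⇒ B))
mainTheorem7 t nt = D⇒B-inhabitants nt , λ where
  (inj₁ refl) → ⇒I (∀I (⇒I (⇒I (ax (suc zero)))))
  (inj₂ refl) → ⇒I (∀I (⇒I (⇒I (ax zero))))
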